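{- Let $\ell\ge 0$ and let $T$ be a finite tree with a vertex $r$ such that every vertex of $T$ is within distance $2\ell+1$ of $r$. Then $c_\ell(T)=1$.
   Context: $\ell$-visibility Cops and Robber on a graph $G$: in round 0 a set of cops each choose a vertex, then a single robber chooses a vertex. In each subsequent round, every cop moves to a neighbouring vertex or stays put, and then the robber moves to a neighbouring vertex or stays put. The robber always knows the positions of all cops. The cops know the robber's position only at moments when some cop and the robber occupy vertices $x,y$ with $d(x,y)\le \ell$. The cops capture the robber if a cop occupies the robber's vertex. $c_\ell(G)$ is the minimum number of cops that can guarantee capture. -}

module Defs where

open import Data.Nat using (ℕ; zero; suc; _+_)
open import Data.Fin using (Fin; zero; suc; inject₁; fromℕ; _≟_)
open import Data.Bool using (Bool; true; false; _∨_; _∧_; if_then_else_)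
open import Data.List using (List; []; _∷_; allFin)
open import Data.Bool.ListAction using (any)
open import Data.Maybe using (Maybe; just; nothing)
open import Data.Product using (Σ; ∃; _×_; _,_; proj₁; proj₂)
open import Data.Sum using (_⊎_)
open import Relation.Nullary using (¬_)
open import Relation.Nullary.Decidable using (⌊_⌋)
open import Relation.Binary.PropositionalEquality using (_≡_)
open import Function.Definitions using (Injective)

record Graph (n : ℕ) : Set where
  field
    adj    : Fin n → Fin n → Bool
    sym    : ∀ x y → adj x y ≡ adj y x
    irrefl : ∀ x → adj x x ≡ false
open Graph public

Adj : ∀ {n} → Graph n → Fin n → Fin n → Set
Adj G x y = adj G x y ≡ true

within : ∀ {n} → Graph n → ℕ → Fin n → Fin n → Bool
within {n} G zero    x y = ⌊ x ≟ y ⌋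
within {n} G (suc k) x y = within G k x y ∨ any (λ z → adj G x z ∧ within G k z y) (allFin n)

Connected : ∀ {n} → Graph n → Set
Connected G = ∀ x y → ∃ λ k → within G k x y ≡ true

-- A cycle of length m+3: distinct vertices f 0, ..., f (m+2), consecutive ones adjacent,
-- and the last adjacent to the first.
record Cycle {n : ℕ} (G : Graph n) : Set where
  field
    m     : ℕ
    f     : Fin (suc (suc (suc m))) → Fin n
    inj   : Injective _≡_ _≡_ f
    step  : ∀ (i : Fin (suc (suc m))) → Adj G (f (inject₁ i)) (f (suc i))
    close : Adj G (f (fromℕ (suc (suc m)))) (f zero)

IsTree : ∀ {n} → Graph n → Set
IsTree G = Connected G × ¬ Cycle G

Positions : ℕ → ℕ → Set
Positions n k = Fin k → Fin n

observe : ∀ {n k} → Graph n → ℕ → Positions n k → Fin n → Maybe (Fin n)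
observe {n} {k} G ℓ cs r =
  if any (λ i → within G ℓ (cs i) r) (allFin k) then just r else nothing

LegalMove : ∀ {n k} → Graph n → Positions n k → Positions n k → Set
LegalMove G cs cs' = ∀ i → cs' i ≡ cs i ⊎ Adj G (cs i) (cs' i)

-- A (deterministic) cop strategy: initial placement, and a move chosen from the
-- history of observations (newest first) and the current cop positions.
record CopStrategy {n : ℕ} (G : Graph n) (k : ℕ) : Set where
  field
    start : Positions n k
    next  : List (Maybe (Fin n)) → (cs : Positions n k) → Σ (Positions n k) (LegalMove G cs)
open CopStrategy public

-- A robber trajectory: pos t is the robber's vertex after its move in round t.
record RobberWalk {n : ℕ} (G : Graph n) : Set where
  field
    pos   : ℕ → Fin n
    legal : ∀ t → pos (suc t) ≡ pos t ⊎ Adj G (pos t) (pos (suc t))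
open RobberWalk public

-- state t = (cop positions after the cops' move in round t, observation history
-- up to the end of round t).  Observations are taken after every move.
state : ∀ {n k} (G : Graph n) (ℓ : ℕ) → CopStrategy G k → RobberWalk G → ℕ →
        Positions n k × List (Maybe (Fin n))
state G ℓ σ R zero = start σ , (observe G ℓ (start σ) (pos R zero) ∷ [])
state G ℓ σ R (suc t) =
  let cs  = proj₁ (state G ℓ σ R t)
      h   = proj₂ (state G ℓ σ R t)
      cs' = proj₁ (next σ h cs)
  in cs' , (observe G ℓ cs' (pos R (suc t)) ∷ observe G ℓ cs' (pos R t) ∷ h)

copPos : ∀ {n k} (G : Graph n) (ℓ : ℕ) → CopStrategy G k → RobberWalk G → ℕ → Positions n k
copPos G ℓ σ R t = proj₁ (state G ℓ σ R t)

-- Capture: at some moment a cop shares the robber's vertex (after the robber's move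
-- in round t, or after the cops' move in round t+1).
Captured : ∀ {n k} (G : Graph n) (ℓ : ℕ) → CopStrategy G k → RobberWalk G → Set
Captured G ℓ σ R = ∃ λ t → ∃ λ i →
  copPos G ℓ σ R t i ≡ pos R t ⊎ copPos G ℓ σ R (suc t) i ≡ pos R t

CopsWin : ∀ {n} → ℕ → Graph n → ℕ → Set
CopsWin ℓ G k = Σ (CopStrategy G k) λ σ → ∀ (R : RobberWalk G) → Captured G ℓ σ R

CopNumberIsOne : ∀ {n} → ℕ → Graph n → Set
CopNumberIsOne ℓ G = CopsWin ℓ G 1 × ¬ CopsWin ℓ G 0

module Submission where

-- Root T at r.  Every vertex v ≠ r gets a parent one level closer to r, and
-- since T has no cycle every edge joins a vertex to its parent; hence a walk
-- enters or leaves the subtree below c only through c and its parent.  The cop performs a depth-first sweep of the vertices of depth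
--   ≤ ℓ+1.  The anchor of a vertex z, its ancestor at depth min(depth z, ℓ+1),
--   is within ℓ of z.  As long as the robber is unseen, its anchor stays
--   unvisited; a potential shows the sweep finishes, with everything visited.  Once seen, the cop steps towards the last sighting: down into the
--   subtree containing it, or up.  The robber stays within ℓ after each cop
--   move while a measure ("gap") decreases, so the robber is caught.

open import Defs hiding (sym)
open import Data.Nat as ℕ using (ℕ; zero; suc; _+_; _*_; _∸_; _≤_; _<_; z≤n; s≤s; s≤s⁻¹; _≤?_; _<?_; ⌊_/2⌋)
open import Data.Nat.Properties hiding (_≟_)
open import Data.Fin using (Fin; zero; suc; _≟_; toℕ; inject₁; fromℕ)
open import Data.Fin.Properties using (any?; toℕ-injective; toℕ<n; toℕ-inject₁; toℕ-fromℕ)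
open import Data.Bool as Bool using (true; false; T; if_then_else_)
open import Data.Bool.Properties using (T-≡; T-∨; T-∧)
open import Data.List using (List; []; _∷_; allFin; length)
open import Data.Vec using (_∷_; there)
open import Data.List.Relation.Unary.Any using (satisfied)
open import Data.List.Relation.Unary.Any.Properties using (any⁺; any⁻)
open import Data.List.Membership.Propositional using (lose)
open import Data.List.Membership.Propositional.Properties using (∈-allFin)
open import Data.Maybe using (Maybe; just; nothing)
open import Data.Fin.Subset using (Subset; _∈_; _∉_; _-_; ⊤; ∣_∣)
open import Data.Fin.Subset.Properties using (_∈?_; ∈⊤; p─q⊆p; x∈p∧x≢y⇒x∈p-y; x∈p⇒∣p-x∣<∣p∣)
open import Data.Product using (∃; _×_; _,_; proj₁; proj₂)
open import Data.Sum using (_⊎_; inj₁; inj₂)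
open import Data.Empty using (⊥; ⊥-elim)
open import Function using (_∘_; Equivalence)
open import Relation.Nullary using (¬_; Dec; yes; no)
open import Relation.Nullary.Decidable using (toWitness; fromWitness; _×-dec_; ¬?)
open import Relation.Unary using (Decidable)
open import Relation.Binary.PropositionalEquality using (_≡_; _≢_; refl; sym; trans; cong; cong₂; subst; subst₂; module ≡-Reasoning)

open Equivalence using (to; from)

least : {P : ℕ → Set} → Decidable P → ℕ → ℕ
least P? zero = zero
least P? (suc N) with P? zero
... | yes _ = zero
... | no  _ = suc (least (P? ∘ suc) N)

least-satisfies : ∀ {P : ℕ → Set} (P? : Decidable P) N {j} → P j → j ≤ N → P (least P? N)
least-satisfies P? zero    p z≤n = p
least-satisfies P? (suc N) p j≤ with P? zero
... | yes p₀ = p₀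
least-satisfies P? (suc N) {zero}  p _         | no ¬p₀ = ⊥-elim (¬p₀ p)
least-satisfies P? (suc N) {suc j} p (s≤s j≤N) | no _   = least-satisfies (P? ∘ suc) N p j≤N

least-minimal : ∀ {P : ℕ → Set} (P? : Decidable P) N {j} → P j → least P? N ≤ j
least-minimal P? zero    p = z≤n
least-minimal P? (suc N) p with P? zero
... | yes _ = z≤n
least-minimal P? (suc N) {zero}  p | no ¬p₀ = ⊥-elim (¬p₀ p)
least-minimal P? (suc N) {suc j} p | no _   = s≤s (least-minimal (P? ∘ suc) N p)

least-≤ : ∀ {P : ℕ → Set} (P? : Decidable P) N → least P? N ≤ N
least-≤ P? zero = z≤n
least-≤ P? (suc N) with P? zero
... | yes _ = z≤n
... | no  _ = s≤s (least-≤ (P? ∘ suc) N)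

x∉p-x : ∀ {n} {p : Subset n} x → x ∉ p - x
x∉p-x {p = _ ∷ _} zero    ()
x∉p-x {p = _ ∷ _} (suc x) (there x∈) = x∉p-x x x∈

module Distance {n : ℕ} (G : Graph n) where

  adj-sym : ∀ {x y} → Adj G x y → Adj G y x
  adj-sym {x} {y} a = trans (Graph.sym G y x) a

  adj-irrefl : ∀ {x y} → Adj G x y → x ≢ y
  adj-irrefl {x} a refl with trans (sym a) (irrefl G x)
  ... | ()

  Move : Fin n → Fin n → Set
  Move x y = y ≡ x ⊎ Adj G x y

  move-sym : ∀ {x y} → Move x y → Move y x
  move-sym (inj₁ refl) = inj₁ refl
  move-sym (inj₂ a)    = inj₂ (adj-sym a)

  -- `Near k x y`: d(x,y) ≤ k.  (A record, so that x and y can be inferred.)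
  record Near (k : ℕ) (x y : Fin n) : Set where
    constructor near
    field holds : T (within G k x y)

  near? : ∀ k x y → Dec (Near k x y)
  near? k x y with Bool.T? (within G k x y)
  ... | yes t = yes (near t)
  ... | no ¬t = no λ (near t) → ¬t t

  near-from-≡ : ∀ {k x y} → within G k x y ≡ true → Near k x y
  near-from-≡ e = near (from T-≡ e)

  near-zero : ∀ {x y} → Near 0 x y → x ≡ y
  near-zero (near t) = toWitness t

  near-refl : ∀ x → Near 0 x x
  near-refl x = near (fromWitness refl)

  near-weaken : ∀ {k x y} → Near k x y → Near (suc k) x y
  near-weaken (near t) = near (from T-∨ (inj₁ t))

  near-cons : ∀ {k x w y} → Adj G x w → Near k w y → Near (suc k) x y
  near-cons {w = w} a (near t) =
    near (from T-∨ (inj₂ (any⁺ _ (lose (∈-allFin w) (from T-∧ (from T-≡ a , t))))))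

  near-uncons : ∀ {k x y} → Near (suc k) x y → Near k x y ⊎ ∃ λ w → Adj G x w × Near k w y
  near-uncons (near t) with to T-∨ t
  ... | inj₁ t₀ = inj₁ (near t₀)
  ... | inj₂ t₁ with satisfied (any⁻ _ (allFin n) t₁)
  ... | w , tw = let (ta , tn) = to T-∧ tw in inj₂ (w , to T-≡ ta , near tn)

  near-mono : ∀ {k k' x y} → k ≤ k' → Near k x y → Near k' x y
  near-mono {k} {k'} {x} {y} k≤k' p = subst (λ m → Near m x y) (m∸n+n≡m k≤k') (pad (k' ∸ k))
    where pad : ∀ d → Near (d + k) x y
          pad zero    = p
          pad (suc d) = near-weaken (pad d)

  near-trans : ∀ j {k x y z} → Near j x y → Near k y z → Near (j + k) x z
  near-trans zero    p q with near-zero p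
  ... | refl = q
  near-trans (suc j) p q with near-uncons p
  ... | inj₁ p'           = near-weaken (near-trans j p' q)
  ... | inj₂ (w , a , p') = near-cons a (near-trans j p' q)

  near-adj : ∀ {x y} → Adj G x y → Near 1 x y
  near-adj a = near-cons a (near-refl _)

  near-snoc : ∀ k {x w y} → Near k x w → Adj G w y → Near (suc k) x y
  near-snoc k {x} {w} {y} p a = subst (λ m → Near m x y) (+-comm k 1) (near-trans k p (near-adj a))

  near-then-step : ∀ k {x y y'} → Near k x y → Move y y' → Near (suc k) x y'
  near-then-step k p (inj₁ refl) = near-weaken p
  near-then-step k p (inj₂ a)    = near-snoc k p a

  near-sym : ∀ k {x y} → Near k x y → Near k y x
  near-sym zero    p with near-zero p
  ... | refl = near-refl _
  near-sym (suc k) p with near-uncons p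
  ... | inj₁ q           = near-weaken (near-sym k q)
  ... | inj₂ (w , a , q) = near-snoc k (near-sym k q) (adj-sym a)

  near-unsnoc : ∀ k {x y} → Near (suc k) x y → Near k x y ⊎ ∃ λ w → Near k x w × Adj G w y
  near-unsnoc k p with near-uncons (near-sym (suc k) p)
  ... | inj₁ q           = inj₁ (near-sym k q)
  ... | inj₂ (w , a , q) = inj₂ (w , near-sym k q , adj-sym a)

  cycle-from-sequence : (m : ℕ) (g : ℕ → Fin n) →
    (∀ {p q} → p ≤ suc (suc m) → q ≤ suc (suc m) → g p ≡ g q → p ≡ q) →
    (∀ {p} → p ≤ suc m → Adj G (g p) (g (suc p))) →
    Adj G (g (suc (suc m))) (g 0) → Cycle G
  cycle-from-sequence m g distinct step close = record
    { m     = m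
    ; f     = g ∘ toℕ
    ; inj   = λ {x} {y} e → toℕ-injective (distinct (bound x) (bound y) e)
    ; step  = λ i → subst (λ k → Adj G (g k) (g (suc (toℕ i)))) (sym (toℕ-inject₁ i)) (step (bound i))
    ; close = subst (λ k → Adj G (g k) (g 0)) (sym (toℕ-fromℕ (suc (suc m)))) close
    }
    where bound : ∀ {k} (x : Fin (suc k)) → toℕ x ≤ k
          bound x = s≤s⁻¹ (toℕ<n x)

module Rooted {n : ℕ} (G : Graph n) (r : Fin n) (N : ℕ)
              (spans : ∀ v → Distance.Near G N r v) where
  open Distance G

  depth : Fin n → ℕ
  depth v = least (λ k → near? k r v) N

  depth-near : ∀ v → Near (depth v) r v
  depth-near v = least-satisfies (λ k → near? k r v) N (spans v) ≤-refl

  depth-minimal : ∀ {k v} → Near k r v → depth v ≤ k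
  depth-minimal {v = v} = least-minimal (λ k → near? k r v) N

  depth-≤ : ∀ v → depth v ≤ N
  depth-≤ v = least-≤ (λ k → near? k r v) N

  depth-root : ∀ {v} → v ≡ r → depth v ≡ 0
  depth-root refl = n≤0⇒n≡0 (depth-minimal (near-refl r))

  depth-zero : ∀ {v} → depth v ≡ 0 → v ≡ r
  depth-zero {v} e = sym (near-zero (subst (λ k → Near k r v) e (depth-near v)))

  depth-adj : ∀ {v w} → Adj G v w → depth w ≤ suc (depth v)
  depth-adj {v} a = depth-minimal (near-snoc _ (depth-near v) a)

  IsParent : Fin n → Fin n → Set
  IsParent v w = Adj G v w × suc (depth w) ≡ depth v

  isParent? : ∀ v w → Dec (IsParent v w)
  isParent? v w = (adj G v w Bool.≟ true) ×-dec (suc (depth w) ℕ.≟ depth v)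

  -- The last edge of a shortest walk from r to v ≠ r leads to a parent of v.
  parent-exists : ∀ {v} → v ≢ r → ∃ (IsParent v)
  parent-exists {v} v≢r with depth v in eq
  ... | zero  = ⊥-elim (v≢r (depth-zero eq))
  ... | suc k with near-unsnoc k (subst (λ m → Near m r v) eq (depth-near v))
  ...   | inj₁ shorter = ⊥-elim (1+n≰n (subst (_≤ k) eq (depth-minimal shorter)))
  ...   | inj₂ (w , r~w , w~v) =
          w , adj-sym w~v , ≤-antisym (s≤s (depth-minimal r~w)) (subst (_≤ suc (depth w)) eq (depth-adj w~v))

  -- The chosen parent; the root is its own parent.
  parent : Fin n → Fin n
  parent v with any? (isParent? v)
  ... | yes (w , _) = w
  ... | no _        = r

  parent-spec : ∀ {v} → v ≢ r → IsParent v (parent v)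
  parent-spec {v} v≢r with any? (isParent? v)
  ... | yes (_ , p) = p
  ... | no ¬p       = ⊥-elim (¬p (parent-exists v≢r))

  parent-root : ∀ {v} → v ≡ r → parent v ≡ r
  parent-root {v} refl with any? (isParent? v)
  ... | yes (_ , _ , e) = ⊥-elim (0≢1+n (sym (trans e (depth-root refl))))
  ... | no _            = refl

  parent-adj : ∀ {v} → v ≢ r → Adj G v (parent v)
  parent-adj v≢r = proj₁ (parent-spec v≢r)

  depth-parent : ∀ {v} → v ≢ r → depth v ≡ suc (depth (parent v))
  depth-parent v≢r = sym (proj₂ (parent-spec v≢r))

  depth-parent-pred : ∀ v → depth (parent v) ≡ depth v ∸ 1
  depth-parent-pred v with v ≟ r
  ... | yes v≡r = trans (depth-root (parent-root v≡r)) (sym (cong (_∸ 1) (depth-root v≡r)))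
  ... | no v≢r  = sym (cong (_∸ 1) (depth-parent v≢r))

  depth-parent-≤ : ∀ v → depth (parent v) ≤ depth v
  depth-parent-≤ v = subst (_≤ depth v) (sym (depth-parent-pred v)) (m∸n≤m (depth v) 1)

  near-parent : ∀ v → Near 1 v (parent v)
  near-parent v with v ≟ r
  ... | yes v≡r = near-weaken (subst (Near 0 v) (sym (trans (parent-root v≡r) (sym v≡r))) (near-refl v))
  ... | no v≢r  = near-adj (parent-adj v≢r)

  -- anc v s: the ancestor s levels above v (the root, once s ≥ depth v).
  anc : Fin n → ℕ → Fin n
  anc v zero    = v
  anc v (suc s) = anc (parent v) s

  anc-+ : ∀ v s t → anc v (s + t) ≡ anc (anc v s) t
  anc-+ v zero    t = refl
  anc-+ v (suc s) t = anc-+ (parent v) s t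

  anc-suc : ∀ v s → anc v (suc s) ≡ parent (anc v s)
  anc-suc v s = trans (cong (anc v) (+-comm 1 s)) (anc-+ v s 1)

  depth-anc : ∀ v s → depth (anc v s) ≡ depth v ∸ s
  depth-anc v zero    = refl
  depth-anc v (suc s) = trans (depth-anc (parent v) s)
                              (trans (cong (_∸ s) (depth-parent-pred v)) (∸-+-assoc (depth v) 1 s))

  anc-top : ∀ v {s} → depth v ≤ s → anc v s ≡ r
  anc-top v {s} le = depth-zero (trans (depth-anc v s) (m≤n⇒m∸n≡0 le))

  near-anc : ∀ v s → Near s v (anc v s)
  near-anc v zero    = near-refl v
  near-anc v (suc s) = near-trans 1 (near-parent v) (near-anc (parent v) s)

  _≼_ : Fin n → Fin n → Set
  c ≼ v = ∃ λ s → anc v s ≡ c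

  ≼-refl : ∀ v → v ≼ v
  ≼-refl v = 0 , refl

  ≼-trans : ∀ {a b c} → a ≼ b → b ≼ c → a ≼ c
  ≼-trans {c = c} (s , bs≡a) (t , ct≡b) = t + s , trans (anc-+ c t s) (trans (cong (λ u → anc u s) ct≡b) bs≡a)

  root-≼ : ∀ v → r ≼ v
  root-≼ v = depth v , anc-top v ≤-refl

  ≼-root : ∀ {c} → c ≼ r → c ≡ r
  ≼-root (s , e) = trans (sym e) (anc-top r (subst (_≤ s) (sym (depth-root refl)) z≤n))

  ≼-child : ∀ {c v} → c ≼ parent v → c ≼ v
  ≼-child (s , e) = suc s , e

  ≼-parent : ∀ {c v} → c ≼ v → v ≢ c → c ≼ parent v
  ≼-parent (zero  , e) v≢c = ⊥-elim (v≢c e)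
  ≼-parent (suc s , e) _   = s , e

  ≼-depth : ∀ {c v} → c ≼ v → depth c ≤ depth v
  ≼-depth {v = v} (s , refl) = subst (_≤ depth v) (sym (depth-anc v s)) (m∸n≤m (depth v) s)

  ≼-exact : ∀ {c v} → c ≼ v → anc v (depth v ∸ depth c) ≡ c
  ≼-exact {v = v} (s , refl) with s ≤? depth v
  ... | yes s≤d = cong (anc v) (trans (cong (depth v ∸_) (depth-anc v s)) (m∸[m∸n]≡n s≤d))
  ... | no s≰d  = trans (anc-top v (≤-reflexive (sym (cong (depth v ∸_) (depth-root at-root))))) (sym at-root)
    where at-root : anc v s ≡ r
          at-root = anc-top v (<⇒≤ (≰⇒> s≰d))

  _≼?_ : ∀ c v → Dec (c ≼ v)
  c ≼? v with anc v (depth v ∸ depth c) ≟ c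
  ... | yes e = yes (depth v ∸ depth c , e)
  ... | no ¬e = no (¬e ∘ ≼-exact)

  ≼-strict : ∀ {c v} → c ≼ v → c ≢ v → depth c < depth v
  ≼-strict {c} {v} c≼v c≢v with m≤n⇒m<n∨m≡n (≼-depth c≼v)
  ... | inj₁ lt = lt
  ... | inj₂ eq = ⊥-elim (c≢v (trans (sym (≼-exact c≼v)) (cong (anc v) (trans (cong (depth v ∸_) eq) (n∸n≡0 (depth v))))))

  near-≼ : ∀ {c v} → c ≼ v → Near (depth v ∸ depth c) v c
  near-≼ {c} {v} c≼v = subst (Near (depth v ∸ depth c) v) (≼-exact c≼v) (near-anc v (depth v ∸ depth c))

  -- For x strictly above y, the child of x on the way down to y.
  child-towards : Fin n → Fin n → Fin n
  child-towards x y = anc y (depth y ∸ suc (depth x))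

  child-towards-≼ : ∀ x y → child-towards x y ≼ y
  child-towards-≼ x y = depth y ∸ suc (depth x) , refl

  module _ {x y : Fin n} (x≼y : x ≼ y) (x<y : depth x < depth y) where
    parent-child-towards : parent (child-towards x y) ≡ x
    parent-child-towards = trans (sym (anc-suc y (depth y ∸ suc (depth x)))) (trans (cong (anc y) (sym (+-∸-assoc 1 x<y))) (≼-exact x≼y))

    depth-child-towards : depth (child-towards x y) ≡ suc (depth x)
    depth-child-towards = trans (depth-anc y (depth y ∸ suc (depth x))) (m∸[m∸n]≡n x<y)

  anc-injective : ∀ v {s t} → s ≤ depth v → t ≤ depth v → anc v s ≡ anc v t → s ≡ t
  anc-injective v {s} {t} s≤ t≤ e =
    ∸-cancelˡ-≡ s≤ t≤ (trans (sym (depth-anc v s)) (trans (cong depth e) (depth-anc v t)))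

  anc-step : ∀ v {s} → s < depth v → Adj G (anc v s) (anc v (suc s))
  anc-step v {s} s<d = subst (Adj G (anc v s)) (sym (anc-suc v s)) (parent-adj below-root)
    where below-root : anc v s ≢ r
          below-root e = m>n⇒m∸n≢0 s<d (trans (sym (depth-anc v s)) (depth-root e))

  -- If v is adjacent to two distinct vertices a, b but lies on neither of their
  -- ancestor chains, the graph has a cycle: from a up to the lowest common
  -- ancestor c of a and b, down to b, and back to a through v.
  module ChainsCycle {v a b : Fin n} (v~a : Adj G v a) (v~b : Adj G v b) (a≢b : a ≢ b)
                     (v⋠a : ¬ v ≼ a) (v⋠b : ¬ v ≼ b) where

    i : ℕ
    i = least (λ s → anc a s ≼? b) (depth a)

    c : Fin n
    c = anc a i

    c≼b : c ≼ b
    c≼b = least-satisfies (λ s → anc a s ≼? b) (depth a)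
            (subst (_≼ b) (sym (anc-top a ≤-refl)) (root-≼ b)) ≤-refl

    i-minimal : ∀ {s} → anc a s ≼ b → i ≤ s
    i-minimal = least-minimal (λ s → anc a s ≼? b) (depth a)

    i≤ : i ≤ depth a
    i≤ = least-≤ (λ s → anc a s ≼? b) (depth a)

    j : ℕ
    j = depth b ∸ depth c

    b-climbs-to-c : anc b j ≡ c
    b-climbs-to-c = ≼-exact c≼b

    j≤ : j ≤ depth b
    j≤ = m∸n≤m (depth b) (depth c)

    -- The cycle: g 0 = a, …, g i = c, …, g (i + j) = b, g (i + j + 1) = v.
    g : ℕ → Fin n
    g p with p ≤? i
    ... | yes _ = anc a p
    ... | no  _ with p ≤? i + j
    ...   | yes _ = anc b (i + j ∸ p)
    ...   | no  _ = v

    g-up : ∀ {p} → p ≤ i → g p ≡ anc a p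
    g-up {p} p≤i with p ≤? i
    ... | yes _  = refl
    ... | no p≰i = ⊥-elim (p≰i p≤i)

    g-down : ∀ {p} → i < p → p ≤ i + j → g p ≡ anc b (i + j ∸ p)
    g-down {p} i<p p≤ with p ≤? i
    ... | yes p≤i = ⊥-elim (<⇒≱ i<p p≤i)
    ... | no  _ with p ≤? i + j
    ...   | yes _  = refl
    ...   | no p≰ = ⊥-elim (p≰ p≤)

    -- at p = i both descriptions name c
    g-down-from-c : ∀ {p} → i ≤ p → p ≤ i + j → g p ≡ anc b (i + j ∸ p)
    g-down-from-c {p} i≤p p≤ with m≤n⇒m<n∨m≡n i≤p
    ... | inj₁ i<p  = g-down i<p p≤
    ... | inj₂ refl = trans (g-up ≤-refl) (trans (sym b-climbs-to-c) (cong (anc b) (sym (m+n∸m≡n i j))))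

    g-back : ∀ {p} → i + j < p → g p ≡ v
    g-back {p} lt with p ≤? i
    ... | yes p≤i = ⊥-elim (<⇒≱ lt (≤-trans p≤i (m≤m+n i j)))
    ... | no  _ with p ≤? i + j
    ...   | yes p≤ = ⊥-elim (<⇒≱ lt p≤)
    ...   | no  _  = refl

    chains-disjoint : ∀ {p t} → p ≤ i → t < j → anc a p ≢ anc b t
    chains-disjoint {p} {t} p≤i t<j e with ≤-antisym p≤i (i-minimal (t , sym e))
    ... | refl = <-irrefl (anc-injective b (≤-trans (<⇒≤ t<j) j≤) j≤ (trans (sym e) (sym b-climbs-to-c))) t<j

    down-index : ∀ {p} → i < p → p ≤ i + j → i + j ∸ p < j
    down-index {p} i<p p≤ = subst (i + j ∸ p <_) (m+n∸m≡n i j) (∸-monoʳ-< i<p p≤)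

    data Piece : ℕ → Set where
      up   : ∀ {p} → p ≤ i → Piece p
      down : ∀ {p} → i < p → p ≤ i + j → Piece p
      back : Piece (suc (i + j))

    piece : ∀ {p} → p ≤ suc (i + j) → Piece p
    piece {p} p≤ with p ≤? i | p ≤? i + j
    ... | yes p≤i | _      = up p≤i
    ... | no p≰i  | yes p≤ = down (≰⇒> p≰i) p≤
    ... | no _    | no p≰  = subst Piece (≤-antisym (≰⇒> p≰) p≤) back

    distinct : ∀ {p q} → Piece p → Piece q → g p ≡ g q → p ≡ q
    distinct (up x)       (up y)       e = anc-injective a (≤-trans x i≤) (≤-trans y i≤)
                                             (trans (sym (g-up x)) (trans e (g-up y)))
    distinct (up x)       (down y₁ y₂) e = ⊥-elim (chains-disjoint x (down-index y₁ y₂)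
                                             (trans (sym (g-up x)) (trans e (g-down y₁ y₂))))
    distinct {p} (up x)   back         e = ⊥-elim (v⋠a (p , trans (sym (g-up x)) (trans e (g-back ≤-refl))))
    distinct (down x₁ x₂) (up y)       e = ⊥-elim (chains-disjoint y (down-index x₁ x₂)
                                             (trans (sym (g-up y)) (trans (sym e) (g-down x₁ x₂))))
    distinct (down x₁ x₂) (down y₁ y₂) e =
      ∸-cancelˡ-≡ x₂ y₂ (anc-injective b (≤-trans (<⇒≤ (down-index x₁ x₂)) j≤)
                                          (≤-trans (<⇒≤ (down-index y₁ y₂)) j≤)
                                          (trans (sym (g-down x₁ x₂)) (trans e (g-down y₁ y₂))))
    distinct {p} (down x₁ x₂) back     e = ⊥-elim (v⋠b (i + j ∸ p , trans (sym (g-down x₁ x₂)) (trans e (g-back ≤-refl))))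
    distinct {q = q} back (up y)       e = ⊥-elim (v⋠a (q , trans (sym (g-up y)) (trans (sym e) (g-back ≤-refl))))
    distinct {q = q} back (down y₁ y₂) e = ⊥-elim (v⋠b (i + j ∸ q , trans (sym (g-down y₁ y₂)) (trans (sym e) (g-back ≤-refl))))
    distinct back         back         e = refl

    step : ∀ {p} → p ≤ i + j → Adj G (g p) (g (suc p))
    step {p} p≤ = by-segment (p <? i) (p <? i + j)
      where
      by-segment : Dec (p < i) → Dec (p < i + j) → Adj G (g p) (g (suc p))
      by-segment (yes p<i) _ =
        subst₂ (Adj G) (sym (g-up (<⇒≤ p<i))) (sym (g-up p<i)) (anc-step a (<-≤-trans p<i i≤))
      by-segment (no p≮i) (yes p<) =
        subst₂ (Adj G) (sym (trans (g-down-from-c (≮⇒≥ p≮i) p≤) (cong (anc b) (+-∸-assoc 1 p<))))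
                       (sym (g-down-from-c (≤-trans (≮⇒≥ p≮i) (n≤1+n p)) p<))
                       (adj-sym (anc-step b (≤-trans (down-index (s≤s (≮⇒≥ p≮i)) p<) j≤)))
      by-segment (no p≮i) (no p≮) =
        subst₂ (Adj G) (sym (trans (g-down-from-c (≮⇒≥ p≮i) p≤) (cong (anc b) (m≤n⇒m∸n≡0 (≮⇒≥ p≮)))))
                       (sym (g-back (s≤s (≮⇒≥ p≮)))) (adj-sym v~b)

    cycle : Cycle G
    cycle with i + j in len
    ... | suc m = cycle-from-sequence m g
                    (λ {p} {q} p≤ q≤ → distinct (piece (subst (λ k → p ≤ suc k) (sym len) p≤))
                                                (piece (subst (λ k → q ≤ suc k) (sym len) q≤)))
                    (λ {p} p≤ → step (subst (p ≤_) (sym len) p≤))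
                    (subst₂ (Adj G) (sym (g-back (subst (_< suc (suc m)) (sym len) ≤-refl))) (sym (g-up z≤n))
                            v~a)
    ... | zero  = ⊥-elim (a≢b (trans (sym (cong (anc a) (m+n≡0⇒m≡0 i len)))
                                (trans (sym b-climbs-to-c) (cong (anc b) (m+n≡0⇒n≡0 i len)))))

module Tree {n : ℕ} (G : Graph n) (r : Fin n) (N : ℕ)
            (spans : ∀ v → Distance.Near G N r v) (acyclic : ¬ Cycle G) where
  open Distance G
  open Rooted G r N spans

  -- A neighbour of v ≠ r that is not deeper than v is its parent: otherwise
  -- v, its parent and that neighbour close a cycle.
  shallow-neighbour-is-parent : ∀ {v w} → v ≢ r → Adj G v w → depth w ≤ depth v → w ≡ parent v
  shallow-neighbour-is-parent {v} {w} v≢r v~w w≤v with w ≟ parent v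
  ... | yes e   = e
  ... | no w≢pv = ⊥-elim (acyclic (ChainsCycle.cycle (parent-adj v≢r) v~w (w≢pv ∘ sym) v⋠pv v⋠w))
    where
    v⋠pv : ¬ v ≼ parent v
    v⋠pv h = 1+n≰n (subst (_≤ depth (parent v)) (depth-parent v≢r) (≼-depth h))
    v⋠w : ¬ v ≼ w
    v⋠w h = <⇒≱ (≼-strict h (adj-irrefl v~w)) w≤v

  edge-parent : ∀ {v w} → Adj G v w → (v ≢ r × w ≡ parent v) ⊎ (w ≢ r × v ≡ parent w)
  edge-parent {v} {w} v~w with depth w ≤? depth v
  ... | yes w≤v = inj₁ (v≢r , shallow-neighbour-is-parent v≢r v~w w≤v)
    where
    v≢r : v ≢ r
    v≢r v≡r = adj-irrefl v~w (trans v≡r (sym (depth-zero (n≤0⇒n≡0 (subst (depth w ≤_) (depth-root v≡r) w≤v)))))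
  ... | no w≰v  = inj₂ (w≢r , shallow-neighbour-is-parent w≢r (adj-sym v~w) (<⇒≤ (≰⇒> w≰v)))
    where
    w≢r : w ≢ r
    w≢r w≡r = <⇒≱ (≰⇒> w≰v) (subst (_≤ depth v) (sym (depth-root w≡r)) z≤n)

  enter-subtree : ∀ {u w c} → Adj G u w → c ≼ w → ¬ c ≼ u → w ≡ c
  enter-subtree {u} {w} {c} u~w c≼w c⋠u with edge-parent u~w
  ... | inj₁ (_ , w≡pu)  = ⊥-elim (c⋠u (≼-child (subst (c ≼_) w≡pu c≼w)))
  ... | inj₂ (_ , u≡pw) with w ≟ c
  ...   | yes w≡c = w≡c
  ...   | no w≢c  = ⊥-elim (c⋠u (subst (c ≼_) (sym u≡pw) (≼-parent c≼w w≢c)))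

  leave-subtree : ∀ {u w c} → Adj G u w → c ≼ u → ¬ c ≼ w → u ≡ c × w ≡ parent c
  leave-subtree {u} {w} {c} u~w c≼u c⋠w with enter-subtree (adj-sym u~w) c≼u c⋠w
  ... | refl with edge-parent u~w
  ...   | inj₁ (_ , w≡pu) = refl , w≡pu
  ...   | inj₂ (_ , u≡pw) = ⊥-elim (c⋠w (≼-child (subst (u ≼_) u≡pw (≼-refl u))))

  step-from-subtree : ∀ {c u w} → c ≼ u → Move u w → c ≼ w ⊎ (u ≡ c × w ≡ parent c)
  step-from-subtree {c} {u} {w} c≼u (inj₁ w≡u) = inj₁ (subst (c ≼_) (sym w≡u) c≼u)
  step-from-subtree {c} {u} {w} c≼u (inj₂ u~w) with c ≼? w
  ... | yes c≼w = inj₁ c≼w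
  ... | no c⋠w  = inj₂ (leave-subtree u~w c≼u c⋠w)

  -- A walk of length ≤ k+1 from outside the subtree of c to a vertex inside it
  -- passes through c, so c is within k of its end.
  near-into-subtree : ∀ k {u z c} → Near (suc k) u z → ¬ c ≼ u → c ≼ z → Near k c z
  near-into-subtree k {u} {z} {c} walk c⋠u c≼z with near-uncons walk
  ... | inj₁ p with k
  ...   | zero   = ⊥-elim (c⋠u (subst (c ≼_) (sym (near-zero p)) c≼z))
  ...   | suc k' = near-weaken (near-into-subtree k' p c⋠u c≼z)
  near-into-subtree k {u} {z} {c} walk c⋠u c≼z | inj₂ (w , u~w , rest) with c ≼? w
  ... | yes c≼w = subst (λ x → Near k x z) (enter-subtree u~w c≼w c⋠u) rest
  ... | no c⋠w with k
  ...   | zero   = ⊥-elim (c⋠w (subst (c ≼_) (sym (near-zero rest)) c≼z))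
  ...   | suc k' = near-weaken (near-into-subtree k' rest c⋠w c≼z)

  -- Likewise a walk leaving the subtree of c passes through the parent of c.
  near-out-of-subtree : ∀ k {u z c} → Near (suc k) u z → c ≼ u → ¬ c ≼ z → Near k (parent c) z
  near-out-of-subtree k {u} {z} {c} walk c≼u c⋠z with near-uncons walk
  ... | inj₁ p with k
  ...   | zero   = ⊥-elim (c⋠z (subst (c ≼_) (near-zero p) c≼u))
  ...   | suc k' = near-weaken (near-out-of-subtree k' p c≼u c⋠z)
  near-out-of-subtree k {u} {z} {c} walk c≼u c⋠z | inj₂ (w , u~w , rest) with c ≼? w
  ... | no c⋠w = subst (λ x → Near k x z) (proj₂ (leave-subtree u~w c≼u c⋠w)) rest
  ... | yes c≼w with k
  ...   | zero   = ⊥-elim (c⋠z (subst (c ≼_) (near-zero rest) c≼w))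
  ...   | suc k' = near-weaken (near-out-of-subtree k' rest c≼w c⋠z)

module Sweep {n : ℕ} (G : Graph n) (r : Fin n) (N : ℕ)
             (spans : ∀ v → Distance.Near G N r v) (D : ℕ) where
  open Distance G
  open Rooted G r N spans

  record State : Set where
    constructor ⟨_,_⟩
    field
      here  : Fin n
      fresh : Subset n
  open State

  Pending : Fin n → Subset n → Fin n → Set
  Pending x U c = parent c ≡ x × c ≢ r × depth c ≤ D × c ∈ U

  pending? : ∀ x U c → Dec (Pending x U c)
  pending? x U c = (parent c ≟ x) ×-dec ¬? (c ≟ r) ×-dec (depth c ≤? D) ×-dec (c ∈? U)

  initial : State
  initial = ⟨ r , ⊤ - r ⟩

  step : State → State
  step ⟨ x , U ⟩ with any? (pending? x U)
  ... | yes (c , _) = ⟨ c , U - c ⟩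
  ... | no _        = ⟨ parent x , U ⟩

  sweep : ℕ → State
  sweep zero    = initial
  sweep (suc t) = step (sweep t)

  record Sound (s : State) : Set where
    field
      here-visited   : here s ∉ fresh s
      root-visited  : r ∉ fresh s
      parent-closed : ∀ {v} → v ∉ fresh s → v ≢ r → parent v ∉ fresh s
      pending-above : ∀ {v c} → v ∉ fresh s → Pending v (fresh s) c → v ≼ here s
      here-shallow   : depth (here s) ≤ D
  open Sound

  sound-initial : Sound initial
  sound-initial = record
    { here-visited   = x∉p-x r
    ; root-visited  = x∉p-x r
    ; parent-closed = λ v∉ v≢r → ⊥-elim (v∉ (x∈p∧x≢y⇒x∈p-y ∈⊤ v≢r))
    ; pending-above = λ {v} v∉ _ → subst (_≼ r) (sym (only-root v∉)) (≼-refl r)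
    ; here-shallow   = subst (_≤ D) (sym (depth-root refl)) z≤n
    }
    where only-root : ∀ {v} → v ∉ ⊤ - r → v ≡ r
          only-root {v} v∉ with v ≟ r
          ... | yes v≡r = v≡r
          ... | no v≢r  = ⊥-elim (v∉ (x∈p∧x≢y⇒x∈p-y ∈⊤ v≢r))

  sound-step : ∀ {s} → Sound s → Sound (step s)
  sound-step {⟨ x , U ⟩} inv with any? (pending? x U)
  ... | yes (c , c-under-x , c≢r , c-shallow , c∈U) = record
    { here-visited   = x∉p-x c
    ; root-visited  = λ r∈ → root-visited inv (p─q⊆p U _ r∈)
    ; parent-closed = closed
    ; pending-above = above
    ; here-shallow   = c-shallow
    }
    where
    closed : ∀ {v} → v ∉ U - c → v ≢ r → parent v ∉ U - c
    closed {v} v∉ v≢r pv∈ with v ≟ c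
    ... | yes refl = here-visited inv (p─q⊆p U _ (subst (_∈ U - v) c-under-x pv∈))
    ... | no v≢c   = parent-closed inv (v∉ ∘ flip-remove v≢c) v≢r (p─q⊆p U _ pv∈)
      where flip-remove : ∀ {v} → v ≢ c → v ∈ U → v ∈ U - c
            flip-remove v≢c v∈ = x∈p∧x≢y⇒x∈p-y v∈ v≢c
    above : ∀ {v c'} → v ∉ U - c → Pending v (U - c) c' → v ≼ c
    above {v} v∉ (pc' , c'≢r , c'-shallow , c'∈) with v ≟ c
    ... | yes v≡c = subst (_≼ c) (sym v≡c) (≼-refl c)
    ... | no v≢c  = ≼-child (subst (v ≼_) (sym c-under-x)
                      (pending-above inv (λ v∈ → v∉ (x∈p∧x≢y⇒x∈p-y v∈ v≢c))
                                         (pc' , c'≢r , c'-shallow , p─q⊆p U _ c'∈)))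
  ... | no nothing-pending = record
    { here-visited   = px-visited
    ; root-visited  = root-visited inv
    ; parent-closed = parent-closed inv
    ; pending-above = above
    ; here-shallow   = ≤-trans (depth-parent-≤ x) (here-shallow inv)
    }
    where
    px-visited : parent x ∉ U
    px-visited with x ≟ r
    ... | yes x≡r = subst (_∉ U) (sym (parent-root x≡r)) (root-visited inv)
    ... | no x≢r  = parent-closed inv (here-visited inv) x≢r
    above : ∀ {v c} → v ∉ U → Pending v U c → v ≼ parent x
    above {v} {c} v∉ pending with v ≟ x
    ... | yes refl = ⊥-elim (nothing-pending (c , pending))
    ... | no v≢x   = ≼-parent (pending-above inv v∉ pending) (v≢x ∘ sym)

  sound : ∀ t → Sound (sweep t)
  sound zero    = sound-initial
  sound (suc t) = sound-step (sound t)

  step-legal : ∀ s → Move (here s) (here (step s))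
  step-legal ⟨ x , U ⟩ with any? (pending? x U)
  ... | yes (c , c-under-x , c≢r , _) = inj₂ (subst (λ p → Adj G p c) c-under-x (adj-sym (parent-adj c≢r)))
  ... | no _ with x ≟ r
  ...   | yes x≡r = inj₁ (trans (parent-root x≡r) (sym x≡r))
  ...   | no x≢r  = inj₂ (parent-adj x≢r)

  step-from-bottom : ∀ s → depth (here s) ≡ D → here (step s) ≡ parent (here s)
  step-from-bottom ⟨ x , U ⟩ at-D with any? (pending? x U)
  ... | yes (c , c-under-x , c≢r , c-shallow , _) =
        ⊥-elim (1+n≰n (subst (_≤ D) (trans (depth-parent c≢r) (cong suc (trans (cong depth c-under-x) at-D)))
                                     c-shallow))
  ... | no _ = refl

  fresh-stays : ∀ s {v} → v ∈ fresh s → v ≢ here (step s) → v ∈ fresh (step s)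
  fresh-stays ⟨ x , U ⟩ v∈ with any? (pending? x U)
  ... | yes (c , _) = x∈p∧x≢y⇒x∈p-y v∈
  ... | no _        = λ _ → v∈

  Finished : State → Set
  Finished s = here s ≡ r × ¬ ∃ (Pending r (fresh s))

  finished? : ∀ s → Dec (Finished s)
  finished? s = (here s ≟ r) ×-dec ¬? (any? (pending? r (fresh s)))

  -- Each step either visits a new vertex one level down or climbs one level, so
  -- twice the number of unvisited vertices plus the depth decreases.
  potential : State → ℕ
  potential s = 2 * ∣ fresh s ∣ + depth (here s)

  potential-step : ∀ s → ¬ Finished s → potential (step s) < potential s
  potential-step ⟨ x , U ⟩ unfinished with any? (pending? x U)
  ... | yes (c , c-under-x , c≢r , _ , c∈U) = begin-strict
    2 * ∣ U - c ∣ + depth c          ≡⟨ cong (2 * ∣ U - c ∣ +_) (trans (depth-parent c≢r) (cong (suc ∘ depth) c-under-x)) ⟩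
    2 * ∣ U - c ∣ + suc (depth x)    ≡⟨ +-suc (2 * ∣ U - c ∣) (depth x) ⟩
    suc (2 * ∣ U - c ∣ + depth x)    <⟨ n<1+n _ ⟩
    2 + 2 * ∣ U - c ∣ + depth x      ≡⟨ cong (_+ depth x) (sym (*-suc 2 ∣ U - c ∣)) ⟩
    2 * suc ∣ U - c ∣ + depth x      ≤⟨ +-monoˡ-≤ (depth x) (*-monoʳ-≤ 2 (x∈p⇒∣p-x∣<∣p∣ c∈U)) ⟩
    2 * ∣ U ∣ + depth x              ∎
    where open ≤-Reasoning
  ... | no nothing-pending = +-monoʳ-< (2 * ∣ U ∣) (subst (depth (parent x) <_) (sym (depth-parent x≢r)) (n<1+n _))
    where x≢r : x ≢ r
          x≢r x≡r = unfinished (x≡r , λ (c , pending) → nothing-pending (c , subst (λ y → Pending y U c) (sym x≡r) pending))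

  finishes : ∃ λ t → Finished (sweep t)
  finishes = run 0 (potential (sweep 0)) ≤-refl
    where
    run : ∀ t k → potential (sweep t) ≤ k → ∃ λ t → Finished (sweep t)
    run t k bound with finished? (sweep t)
    ... | yes done      = t , done
    ... | no unfinished = continue k (<-≤-trans (potential-step (sweep t) unfinished) bound)
      where continue : ∀ k → potential (sweep (suc t)) < k → ∃ λ t → Finished (sweep t)
            continue (suc k) lt = run (suc t) k (s≤s⁻¹ lt)

  finished-covers : ∀ {s} → Sound s → Finished s → ∀ {v} → depth v ≤ D → v ∉ fresh s
  finished-covers {s} inv (at-root , nothing-pending) {v} v-shallow = by-depth (depth v) refl v-shallow
    where
    by-depth : ∀ d {v} → depth v ≡ d → depth v ≤ D → v ∉ fresh s
    by-depth zero    d≡0 _ = subst (_∉ fresh s) (sym (depth-zero d≡0)) (root-visited inv)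
    by-depth (suc d) {v} d≡ v-shallow v∈ =
      nothing-pending (v , pv≡r , v≢r , v-shallow , v∈)
      where
      v≢r : v ≢ r
      v≢r v≡r = 0≢1+n (trans (sym (depth-root v≡r)) d≡)
      pv-visited : parent v ∉ fresh s
      pv-visited = by-depth d (suc-injective (trans (sym (depth-parent v≢r)) d≡))
                             (≤-trans (depth-parent-≤ v) v-shallow)
      pv≡r : parent v ≡ r
      pv≡r = ≼-root (subst (parent v ≼_) at-root
                (pending-above inv pv-visited (refl , v≢r , v-shallow , v∈)))

module Hiding {n : ℕ} (G : Graph n) (r : Fin n) (ℓ : ℕ)
              (spans : ∀ v → Distance.Near G (2 * ℓ + 1) r v) (acyclic : ¬ Cycle G) where
  open Distance G
  open Rooted G r (2 * ℓ + 1) spans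
  open Tree G r (2 * ℓ + 1) spans acyclic
  open Sweep G r (2 * ℓ + 1) spans (suc ℓ)
  open State
  open Sound

  -- The anchor of z is its ancestor at depth min(depth z, ℓ+1).  Since depths
  -- are at most 2ℓ+1, the anchor is within distance ℓ of z.
  anchor : Fin n → Fin n
  anchor z = anc z (depth z ∸ suc ℓ)

  anchor-near : ∀ z → Near ℓ (anchor z) z
  anchor-near z = near-mono (m≤n+o⇒m∸n≤o (depth z) (suc ℓ) depth-bound)
                            (near-sym _ (near-anc z (depth z ∸ suc ℓ)))
    where depth-bound : depth z ≤ suc ℓ + ℓ
          depth-bound = subst (depth z ≤_) (trans (+-comm (2 * ℓ) 1) (cong (λ m → suc (ℓ + m)) (+-identityʳ ℓ)))
                              (depth-≤ z)

  anchor-shallow : ∀ z → depth (anchor z) ≤ suc ℓ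
  anchor-shallow z = subst (_≤ suc ℓ) (sym (depth-anc z (depth z ∸ suc ℓ)))
                       (m≤n+o⇒m∸n≤o (depth z) (depth z ∸ suc ℓ) (subst (depth z ≤_) (+-comm (suc ℓ) _) (m≤n+m∸n (depth z) (suc ℓ))))

  anchor-self : ∀ {z} → depth z ≤ suc ℓ → anchor z ≡ z
  anchor-self {z} shallow = cong (anc z) (m≤n⇒m∸n≡0 shallow)

  anchor-child : ∀ {z z'} → z ≡ parent z' → z' ≢ r → suc ℓ ≤ depth z → anchor z' ≡ anchor z
  anchor-child {z} {z'} refl z'≢r deep =
    cong (anc z') (trans (cong (_∸ suc ℓ) (depth-parent z'≢r)) (+-∸-assoc 1 deep))

  -- What an unseen robber at z maintains during the sweep: its anchor has not
  -- been visited, or (transiently) it sits at the root while the sweeper is at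
  -- the bottom level ℓ+1, just out of sight.
  Hidden : State → Fin n → Set
  Hidden s z = anchor z ∈ fresh s ⊎ (z ≡ r × depth (here s) ≡ suc ℓ)

  hidden-initially : ∀ {z} → ¬ Near ℓ r z → Hidden initial z
  hidden-initially {z} unseen = inj₁ (x∈p∧x≢y⇒x∈p-y ∈⊤ λ a≡r → unseen (subst (λ x → Near ℓ x z) a≡r (anchor-near z)))

  not-hidden-at-end : ∀ {s z} → Sound s → Finished s → ¬ Hidden s z
  not-hidden-at-end {z = z} inv done (inj₁ a∈) = finished-covers inv done (anchor-shallow z) a∈
  not-hidden-at-end inv (at-root , _) (inj₂ (_ , at-bottom)) = 0≢1+n (trans (sym (depth-root at-root)) at-bottom)

  -- A sweeper at depth a ≤ ℓ+1 is within ℓ of its ancestor at depth b, unless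
  -- that ancestor is the root and a = ℓ+1.
  climb-distance : ∀ {a b} → a ≤ suc ℓ → 1 ≤ b ⊎ a ≤ ℓ → a ∸ b ≤ ℓ
  climb-distance {a} {suc b} a≤ (inj₁ _) = ≤-trans (∸-monoʳ-≤ a (s≤s (z≤n {b}))) (m≤n+o⇒m∸n≤o a 1 a≤)
  climb-distance {a} {b}     _  (inj₂ a≤ℓ) = ≤-trans (m∸n≤m a b) a≤ℓ
  climb-distance {a} {zero}  _  (inj₁ ())

  module _ (s : State) (inv : Sound s) where
    private
      x' = here (step s)
      inv' = sound-step inv

    anchor-stays : ∀ {z} → anchor z ∈ fresh s → ¬ Near ℓ x' z → anchor z ∈ fresh (step s)
    anchor-stays {z} a∈ unseen = fresh-stays s a∈ λ a≡x' → unseen (subst (λ x → Near ℓ x z) a≡x' (anchor-near z))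

    robber-climbs : ∀ {z z'} → anchor z ∈ fresh s → z' ≡ parent z → z ≢ r →
                    ¬ Near ℓ x' z → ¬ Near ℓ x' z' → Hidden (step s) z'
    robber-climbs {z} {z'} a∈ z'≡pz z≢r unseen unseen' with depth z ≤? suc ℓ
    ... | no deep = inj₁ (subst (_∈ fresh (step s)) (anchor-child z'≡pz z≢r z'-deep) (anchor-stays a∈ unseen))
      where z'-deep : suc ℓ ≤ depth z'
            z'-deep = s≤s⁻¹ (subst (suc (suc ℓ) ≤_) (trans (depth-parent z≢r) (cong (suc ∘ depth) (sym z'≡pz))) (≰⇒> deep))
    ... | yes shallow with z' ∈? fresh (step s)
    ...   | yes z'∈ = inj₁ (subst (_∈ fresh (step s)) (sym (anchor-self z'-shallow)) z'∈)
      where z'-shallow = ≤-trans (subst (_≤ depth z) (cong depth (sym z'≡pz)) (depth-parent-≤ z)) shallow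
    ...   | no z'∉ with z' ≟ r ×-dec (depth x' ℕ.≟ suc ℓ)
    ...     | yes at-root-while-bottom = inj₂ at-root-while-bottom
    ...     | no ¬special = ⊥-elim (unseen' (near-mono (climb-distance (here-shallow inv') close) (near-≼ z'≼x')))
      where
      z∈ : z ∈ fresh (step s)
      z∈ = subst (_∈ fresh (step s)) (anchor-self shallow) (anchor-stays a∈ unseen)
      z'≼x' : z' ≼ x'
      z'≼x' = pending-above inv' z'∉ (sym z'≡pz , z≢r , shallow , z∈)
      close : 1 ≤ depth z' ⊎ depth x' ≤ ℓ
      close with z' ≟ r
      ... | yes z'≡r = inj₂ (s≤s⁻¹ (≤∧≢⇒< (here-shallow inv') λ e → ¬special (z'≡r , e)))
      ... | no z'≢r  = inj₁ (subst (1 ≤_) (sym (depth-parent z'≢r)) (s≤s z≤n))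

    robber-descends : ∀ {z z'} → anchor z ∈ fresh s → z ≡ parent z' → z' ≢ r →
                      ¬ Near ℓ x' z → x' ≢ z' → Hidden (step s) z'
    robber-descends {z} {z'} a∈ z≡pz' z'≢r unseen x'≢z' with suc ℓ ≤? depth z
    ... | yes deep = inj₁ (subst (_∈ fresh (step s)) (sym (anchor-child z≡pz' z'≢r deep)) (anchor-stays a∈ unseen))
    ... | no shallow = inj₁ (subst (_∈ fresh (step s)) (sym (anchor-self z'-shallow)) (fresh-stays s z'∈ (x'≢z' ∘ sym)))
      where
      z-shallow : depth z ≤ ℓ
      z-shallow = s≤s⁻¹ (≰⇒> shallow)
      z'-shallow : depth z' ≤ suc ℓ
      z'-shallow = subst (_≤ suc ℓ) (sym (trans (depth-parent z'≢r) (cong (suc ∘ depth) (sym z≡pz')))) (s≤s z-shallow)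
      z∈ : z ∈ fresh s
      z∈ = subst (_∈ fresh s) (anchor-self (≤-trans z-shallow (n≤1+n ℓ))) a∈
      z'∈ : z' ∈ fresh s
      z'∈ with z' ∈? fresh s
      ... | yes z'∈ = z'∈
      ... | no z'∉  = ⊥-elim (parent-closed inv z'∉ z'≢r (subst (_∈ fresh s) z≡pz' z∈))

    hidden-step : ∀ {z z'} → Hidden s z → Move z z' →
                  ¬ Near ℓ x' z → ¬ Near ℓ x' z' → x' ≢ z' → Hidden (step s) z'
    hidden-step {z} (inj₂ (z≡r , at-bottom)) _ unseen _ _ =
      ⊥-elim (unseen (subst (Near ℓ x') (sym z≡r) (near-mono x'-depth≤ℓ (subst (λ k → Near k x' r) x'-depth (near-≼ (root-≼ x'))))))
      where
      x'≡px : x' ≡ parent (here s)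
      x'≡px = step-from-bottom s at-bottom
      x'-depth : depth x' ∸ depth r ≡ depth x'
      x'-depth = cong (depth x' ∸_) (depth-root refl)
      x'-depth≤ℓ : depth x' ≤ ℓ
      x'-depth≤ℓ = ≤-reflexive (suc-injective (trans (cong suc (cong depth x'≡px))
                     (trans (sym (depth-parent (λ x≡r → 0≢1+n (trans (sym (depth-root x≡r)) at-bottom)))) at-bottom)))
    hidden-step {z} {z'} (inj₁ a∈) (inj₁ z'≡z) unseen _ _ =
      inj₁ (subst (λ y → anchor y ∈ fresh (step s)) (sym z'≡z) (anchor-stays a∈ unseen))
    hidden-step (inj₁ a∈) (inj₂ z~z') unseen unseen' x'≢z' with edge-parent z~z'
    ... | inj₁ (z≢r , z'≡pz)  = robber-climbs a∈ z'≡pz z≢r unseen unseen'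
    ... | inj₂ (z'≢r , z≡pz') = robber-descends a∈ z≡pz' z'≢r unseen x'≢z'

-- While the robber has not been seen in the last two
-- observations the cop follows the sweep; once it has, the cop chases the
-- last sighting, stepping down towards it if it lies below, and up otherwise.
module Strategy {n : ℕ} (G : Graph n) (r : Fin n) (ℓ : ℕ)
                (spans : ∀ v → Distance.Near G (2 * ℓ + 1) r v) where
  open Distance G
  open Rooted G r (2 * ℓ + 1) spans
  open Sweep G r (2 * ℓ + 1) spans (suc ℓ)
  open State

  -- Move to t if it is adjacent, otherwise stay: every move is legal.
  towards : Fin n → Fin n → Fin n
  towards x t = if adj G x t then t else x

  towards-legal : ∀ x t → Move x (towards x t)
  towards-legal x t with adj G x t in x~t
  ... | true  = inj₂ x~t
  ... | false = inj₁ refl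

  towards-reaches : ∀ {x t} → Move x t → towards x t ≡ t
  towards-reaches {x} {t} t-close with adj G x t
  towards-reaches (inj₁ t≡x) | false = sym t≡x
  towards-reaches (inj₂ ())  | false
  towards-reaches _          | true  = refl

  lastSighting : List (Maybe (Fin n)) → Maybe (Fin n)
  lastSighting (just y ∷ _)           = just y
  lastSighting (nothing ∷ just y ∷ _) = just y
  lastSighting _                      = nothing

  -- One step from x towards y: down to the child of x above y if y is below x
  -- (x itself when y = x), otherwise up to the parent of x.
  chase : Fin n → Fin n → Fin n
  chase x y with x ≼? y
  ... | yes _ = child-towards x y
  ... | no  _ = parent x

  chase-below : ∀ {x y} → x ≼ y → chase x y ≡ child-towards x y
  chase-below {x} {y} x≼y with x ≼? y
  ... | yes _  = refl
  ... | no x⋠y = ⊥-elim (x⋠y x≼y)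

  chase-outside : ∀ {x y} → ¬ x ≼ y → chase x y ≡ parent x
  chase-outside {x} {y} x⋠y with x ≼? y
  ... | yes x≼y = ⊥-elim (x⋠y x≼y)
  ... | no  _   = refl

  -- The target chosen after a history of length k (that is, in round ⌊k/2⌋+1).
  follow : Maybe (Fin n) → Fin n → ℕ → Fin n
  follow (just y) x _ = chase x y
  follow nothing  _ k = here (sweep (suc ⌊ k /2⌋))

  σ : CopStrategy G 1
  σ = record
    { start = λ _ → r
    ; next  = λ h cs → (λ _ → towards (cs zero) (follow (lastSighting h) (cs zero) (length h)))
                     , λ { zero → towards-legal (cs zero) _ }
    }

module Play {n : ℕ} (G : Graph n) (r : Fin n) (ℓ : ℕ)
            (spans : ∀ v → Distance.Near G (2 * ℓ + 1) r v) (acyclic : ¬ Cycle G)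
            (R : RobberWalk G) where
  open Distance G
  open Rooted G r (2 * ℓ + 1) spans
  open Tree G r (2 * ℓ + 1) spans acyclic
  open Sweep G r (2 * ℓ + 1) spans (suc ℓ)
  open State
  open Hiding G r ℓ spans acyclic
  open Strategy G r ℓ spans

  cops : ℕ → Positions n 1
  cops = copPos G ℓ σ R

  cop : ℕ → Fin n
  cop t = cops t zero

  robber : ℕ → Fin n
  robber = pos R

  history : ℕ → List (Maybe (Fin n))
  history t = proj₂ (state G ℓ σ R t)

  Caught : Set
  Caught = Captured G ℓ σ R

  robber-step : ∀ t → Move (robber t) (robber (suc t))
  robber-step = legal R

  -- Two observations are added per round.
  round : ∀ t → ⌊ length (history t) /2⌋ ≡ t
  round zero    = refl
  round (suc t) = cong suc (round t)

  observe-seen : ∀ t {w} → Near ℓ (cop t) w → observe G ℓ (cops t) w ≡ just w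
  observe-seen t {w} (near seen) with within G ℓ (cop t) w
  ... | true = refl

  observe-unseen : ∀ t {w} → ¬ Near ℓ (cop t) w → observe G ℓ (cops t) w ≡ nothing
  observe-unseen t {w} unseen with within G ℓ (cop t) w in eq
  ... | true  = ⊥-elim (unseen (near-from-≡ eq))
  ... | false = refl

  caught-now : ∀ t → cop t ≡ robber t → Caught
  caught-now t e = t , zero , inj₁ e

  caught-after-move : ∀ t → cop (suc t) ≡ robber t → Caught
  caught-after-move t e = t , zero , inj₂ e

  record Sighted (t : ℕ) : Set where
    field
      target      : Fin n
      recorded    : lastSighting (history t) ≡ just target
      target-near : Move target (robber t)
      cop-near    : Near (suc ℓ) (cop t) (robber t)
      target-cop  : target ≡ cop t → Caught

  sighted : ∀ t → Near ℓ (cop (suc t)) (robber (suc t)) ⊎ Near ℓ (cop (suc t)) (robber t) → Sighted (suc t)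
  sighted t seen with near? ℓ (cop (suc t)) (robber (suc t))
  ... | yes seen-now = record
    { target      = robber (suc t)
    ; recorded    = cong (λ o → lastSighting (o ∷ observe G ℓ (cops (suc t)) (robber t) ∷ history t))
                         (observe-seen (suc t) seen-now)
    ; target-near = inj₁ refl
    ; cop-near    = near-weaken seen-now
    ; target-cop  = λ e → caught-now (suc t) (sym e)
    }
  ... | no unseen-now with seen
  ...   | inj₁ seen-now = ⊥-elim (unseen-now seen-now)
  ...   | inj₂ seen-before = record
    { target      = robber t
    ; recorded    = cong₂ (λ o o' → lastSighting (o ∷ o' ∷ history t))
                          (observe-unseen (suc t) unseen-now) (observe-seen (suc t) seen-before)
    ; target-near = robber-step t
    ; cop-near    = near-then-step ℓ seen-before (robber-step t)
    ; target-cop  = λ e → caught-after-move t (sym e)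
    }

  private
    N : ℕ
    N = 2 * ℓ + 1

  -- Progress measure of the chase: below the cop the robber is caught faster the
  -- deeper the cop is; outside, the cop climbs and the measure falls with its depth.
  gap : Fin n → Fin n → ℕ
  gap x z with x ≼? z
  ... | yes _ = N ∸ depth x
  ... | no  _ = suc N + depth x

  gap-below : ∀ {x z} → x ≼ z → gap x z ≡ N ∸ depth x
  gap-below {x} {z} x≼z with x ≼? z
  ... | yes _  = refl
  ... | no x⋠z = ⊥-elim (x⋠z x≼z)

  gap-outside : ∀ {x z} → ¬ x ≼ z → gap x z ≡ suc N + depth x
  gap-outside {x} {z} x⋠z with x ≼? z
  ... | yes x≼z = ⊥-elim (x⋠z x≼z)
  ... | no  _   = refl

  gap-≤ : ∀ x z → gap x z ≤ suc N + depth x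
  gap-≤ x z with x ≼? z
  ... | yes _ = ≤-trans (m∸n≤m N (depth x)) (≤-trans (n≤1+n N) (m≤m+n (suc N) (depth x)))
  ... | no  _ = ≤-refl

  gap-at : ℕ → ℕ
  gap-at t = gap (cop t) (robber t)

  chase-on : ∀ t → Near ℓ (cop (suc t)) (robber t) →
             (robber t ≢ cop (suc t) → robber (suc t) ≢ cop (suc t) → gap-at (suc t) < gap-at t) →
             Caught ⊎ (Sighted (suc t) × gap-at (suc t) < gap-at t)
  chase-on t near-old progress with robber t ≟ cop (suc t) | robber (suc t) ≟ cop (suc t)
  ... | yes e  | _      = inj₁ (caught-after-move t (sym e))
  ... | no _   | yes e  = inj₁ (caught-now (suc t) (sym e))
  ... | no z≢x | no z'≢x = inj₂ (sighted t (inj₂ near-old) , progress z≢x z'≢x)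

  module _ (t : ℕ) (S : Sighted t) where
    open Sighted S
    private
      x = cop t
      y = target
      z = robber t

    cop-chases : cop (suc t) ≡ towards x (chase x y)
    cop-chases = cong (λ m → towards x (follow m x (length (history t)))) recorded

    -- The sighting is below the cop: the cop steps down to the child c above it,
    -- the robber cannot have left the subtree of c, and c is deeper than x.
    chase-down : x ≼ y → y ≢ x → z ≢ x → Caught ⊎ (Sighted (suc t) × gap-at (suc t) < gap-at t)
    chase-down x≼y y≢x z≢x = chase-on t (subst (λ v → Near ℓ v z) (sym x'≡c) c-near-z) progress
      where
      x<y = ≼-strict x≼y (y≢x ∘ sym)
      c = child-towards x y
      pc≡x : parent c ≡ x
      pc≡x = parent-child-towards x≼y x<y
      c≢r : c ≢ r
      c≢r c≡r = 0≢1+n (trans (sym (depth-root c≡r)) (depth-child-towards x≼y x<y))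
      c⋠x : ¬ c ≼ x
      c⋠x c≼x = 1+n≰n (subst (_≤ depth x) (depth-child-towards x≼y x<y) (≼-depth c≼x))
      x'≡c : cop (suc t) ≡ c
      x'≡c = trans cop-chases (trans (cong (towards x) (chase-below x≼y))
               (towards-reaches (inj₂ (subst (λ p → Adj G p c) pc≡x (adj-sym (parent-adj c≢r))))))
      c≼z : c ≼ z
      c≼z with step-from-subtree (child-towards-≼ x y) target-near
      ... | inj₁ c≼z           = c≼z
      ... | inj₂ (_ , z≡pc)    = ⊥-elim (z≢x (trans z≡pc pc≡x))
      c-near-z : Near ℓ c z
      c-near-z = near-into-subtree ℓ cop-near c⋠x c≼z
      progress : z ≢ cop (suc t) → robber (suc t) ≢ cop (suc t) → gap-at (suc t) < gap-at t
      progress z≢x' _ with step-from-subtree c≼z (robber-step t)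
      ... | inj₂ (z≡c , _) = ⊥-elim (z≢x' (trans z≡c (sym x'≡c)))
      ... | inj₁ c≼z' = begin-strict
        gap (cop (suc t)) (robber (suc t)) ≡⟨ cong (λ v → gap v (robber (suc t))) x'≡c ⟩
        gap c (robber (suc t))             ≡⟨ gap-below c≼z' ⟩
        N ∸ depth c                        ≡⟨ cong (N ∸_) (depth-child-towards x≼y x<y) ⟩
        N ∸ suc (depth x)                  <⟨ ∸-monoʳ-< (n<1+n (depth x)) (subst (_≤ N) (depth-child-towards x≼y x<y) (depth-≤ c)) ⟩
        N ∸ depth x                        ≡⟨ sym (gap-below (≼-trans (1 , pc≡x) c≼z)) ⟩
        gap x z                            ∎
        where open ≤-Reasoning

    -- The sighting is not below the cop: then neither is the robber, and the
    -- cop climbs to its parent, which keeps the robber within ℓ.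
    chase-up : ¬ x ≼ y → z ≢ x → Caught ⊎ (Sighted (suc t) × gap-at (suc t) < gap-at t)
    chase-up x⋠y z≢x = chase-on t (subst (λ v → Near ℓ v z) (sym x'≡px) (near-out-of-subtree ℓ cop-near (≼-refl x) x⋠z)) progress
      where
      x≢r : x ≢ r
      x≢r x≡r = x⋠y (subst (_≼ y) (sym x≡r) (root-≼ y))
      x⋠z : ¬ x ≼ z
      x⋠z x≼z with step-from-subtree x≼z (move-sym target-near)
      ... | inj₁ x≼y          = x⋠y x≼y
      ... | inj₂ (z≡x , _)    = z≢x z≡x
      x'≡px : cop (suc t) ≡ parent x
      x'≡px = trans cop-chases (trans (cong (towards x) (chase-outside x⋠y)) (towards-reaches (inj₂ (parent-adj x≢r))))
      progress : z ≢ cop (suc t) → robber (suc t) ≢ cop (suc t) → gap-at (suc t) < gap-at t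
      progress _ _ = begin-strict
        gap (cop (suc t)) (robber (suc t)) ≤⟨ gap-≤ (cop (suc t)) (robber (suc t)) ⟩
        suc N + depth (cop (suc t))        ≡⟨ cong (λ v → suc N + depth v) x'≡px ⟩
        suc N + depth (parent x)           <⟨ +-monoʳ-< (suc N) (subst (depth (parent x) <_) (sym (depth-parent x≢r)) (n<1+n _)) ⟩
        suc N + depth x                    ≡⟨ sym (gap-outside x⋠z) ⟩
        gap x z                            ∎
        where open ≤-Reasoning

    chase-step : Caught ⊎ (Sighted (suc t) × gap-at (suc t) < gap-at t)
    chase-step with z ≟ x | y ≟ x
    ... | yes z≡x | _       = inj₁ (caught-now t (sym z≡x))
    ... | no _    | yes y≡x = inj₁ (target-cop y≡x)
    ... | no z≢x  | no y≢x with x ≼? y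
    ...   | yes x≼y = chase-down x≼y y≢x z≢x
    ...   | no x⋠y  = chase-up x⋠y z≢x

  chase-wins : ∀ t → Sighted t → Caught
  chase-wins t S = run (gap-at t) t ≤-refl S
    where
    run : ∀ k t → gap-at t ≤ k → Sighted t → Caught
    run k t bound S with chase-step t S
    ... | inj₁ caught = caught
    ... | inj₂ (S' , smaller) with k
    ...   | zero   = ⊥-elim (<⇒≱ smaller (≤-trans bound z≤n))
    ...   | suc k' = run k' (suc t) (s≤s⁻¹ (<-≤-trans smaller bound)) S'

  record Searching (t : ℕ) : Set where
    field
      on-sweep    : cop t ≡ here (sweep t)
      no-sighting : lastSighting (history t) ≡ nothing
      hidden      : Hidden (sweep t) (robber t)

  search-start : Caught ⊎ Sighted 0 ⊎ Searching 0
  search-start with near? ℓ r (robber 0)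
  ... | yes seen = inj₂ (inj₁ record
    { target      = robber 0
    ; recorded    = cong (λ o → lastSighting (o ∷ [])) (observe-seen 0 seen)
    ; target-near = inj₁ refl
    ; cop-near    = near-weaken seen
    ; target-cop  = λ e → caught-now 0 (sym e)
    })
  ... | no unseen = inj₂ (inj₂ record
    { on-sweep    = refl
    ; no-sighting = cong (λ o → lastSighting (o ∷ [])) (observe-unseen 0 unseen)
    ; hidden      = hidden-initially unseen
    })

  cop-follows-sweep : ∀ t → Searching t → cop (suc t) ≡ here (sweep (suc t))
  cop-follows-sweep t searching = begin
    cop (suc t)                                                    ≡⟨ cong (λ m → towards (cop t) (follow m (cop t) (length (history t)))) no-sighting ⟩
    towards (cop t) (here (sweep (suc ⌊ length (history t) /2⌋)))  ≡⟨ cong (λ k → towards (cop t) (here (sweep (suc k)))) (round t) ⟩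
    towards (cop t) (here (sweep (suc t)))                         ≡⟨ towards-reaches (subst (λ v → Move v (here (sweep (suc t)))) (sym on-sweep) (step-legal (sweep t))) ⟩
    here (sweep (suc t))                                           ∎
    where open ≡-Reasoning
          open Searching searching

  search-step : ∀ t → Searching t → Caught ⊎ Sighted (suc t) ⊎ Searching (suc t)
  search-step t searching =
    by-sight (near? ℓ (cop (suc t)) (robber (suc t))) (near? ℓ (cop (suc t)) (robber t)) (robber (suc t) ≟ cop (suc t))
    where
    x'≡sweep = cop-follows-sweep t searching
    by-sight : Dec (Near ℓ (cop (suc t)) (robber (suc t))) → Dec (Near ℓ (cop (suc t)) (robber t)) →
               Dec (robber (suc t) ≡ cop (suc t)) → Caught ⊎ Sighted (suc t) ⊎ Searching (suc t)
    by-sight (yes seen) _ _ = inj₂ (inj₁ (sighted t (inj₁ seen)))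
    by-sight (no _) (yes seen) _ = inj₂ (inj₁ (sighted t (inj₂ seen)))
    by-sight (no _) (no _) (yes e) = inj₁ (caught-now (suc t) (sym e))
    by-sight (no unseen') (no unseen) (no z'≢x') = inj₂ (inj₂ record
      { on-sweep    = x'≡sweep
      ; no-sighting = cong₂ (λ o o' → lastSighting (o ∷ o' ∷ history t))
                            (observe-unseen (suc t) unseen') (observe-unseen (suc t) unseen)
      ; hidden      = hidden-step (sweep t) (sound t) (Searching.hidden searching) (robber-step t)
                        (λ w → unseen (subst (λ v → Near ℓ v (robber t)) (sym x'≡sweep) w))
                        (λ w → unseen' (subst (λ v → Near ℓ v (robber (suc t))) (sym x'≡sweep) w))
                        (λ e → z'≢x' (sym (trans x'≡sweep e)))
      })

  progress : ∀ t → Caught ⊎ (∃ Sighted) ⊎ Searching t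
  progress zero with search-start
  ... | inj₁ caught          = inj₁ caught
  ... | inj₂ (inj₁ S)        = inj₂ (inj₁ (0 , S))
  ... | inj₂ (inj₂ searching) = inj₂ (inj₂ searching)
  progress (suc t) with progress t
  ... | inj₁ caught               = inj₁ caught
  ... | inj₂ (inj₁ S)             = inj₂ (inj₁ S)
  ... | inj₂ (inj₂ searching) with search-step t searching
  ...   | inj₁ caught              = inj₁ caught
  ...   | inj₂ (inj₁ S)            = inj₂ (inj₁ (suc t , S))
  ...   | inj₂ (inj₂ searching')   = inj₂ (inj₂ searching')

  caught : Caught
  caught with finishes
  ... | t , done with progress t
  ...   | inj₁ c             = c
  ...   | inj₂ (inj₁ (t' , S)) = chase-wins t' S
  ...   | inj₂ (inj₂ searching) = ⊥-elim (not-hidden-at-end (sound t) done (Searching.hidden searching))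

no-cops-lose : ∀ {n} ℓ (G : Graph n) → Fin n → ¬ CopsWin ℓ G 0
no-cops-lose ℓ G v (σ , wins) with wins (record { pos = λ _ → v ; legal = λ _ → inj₁ refl })
... | _ , () , _

mainTheorem9 : (ℓ n : ℕ) (T : Graph n) → IsTree T → (r : Fin n) →
    (∀ v → within T (2 * ℓ + 1) r v ≡ true) → CopNumberIsOne ℓ T
mainTheorem9 ℓ n T (_ , acyclic) r radius =
  (Strategy.σ T r ℓ spans , Play.caught T r ℓ spans acyclic) , no-cops-lose ℓ T r
  where spans : ∀ v → Distance.Near T (2 * ℓ + 1) r v
        spans v = Distance.near-from-≡ T (radius v)
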